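{- The theory $\mathbf{V}\cup\mathbf{K}\cup\mathbf{KK}$ is not generic.
   Context: Fix a nonempty set of symbols called propositional atoms and a symbol $\mathrm{K}$ which is not a propositional atom. Formulas are defined recursively: every propositional atom is a formula; if $\varphi,\psi$ are formulas then so are $\neg\varphi$, $(\varphi\wedge\psi)$, $(\varphi\vee\psi)$, $(\varphi\rightarrow\psi)$; if $\varphi$ is a formula then so is $\mathrm{K}(\varphi)$. A formula is basic if it is a propositional atom or of the form $\mathrm{K}\varphi$. A theory is a set of formulas. A model is a function assigning a truth value to every basic formula; truth $\mathscr M\models\varphi$ of an arbitrary formula is defined from the values of basic formulas by the classical truth tables (formulas $\mathrm{K}\varphi$ are treated like atoms). $\mathscr M\models T$ means $\mathscr M\models\varphi$ for all $\varphi\in T$; $T\models\varphi$ means every model of $T$ satisfies $\varphi$; $\varphi$ is valid if $\emptyset\models\varphi$. $\mathbf{V}=\{\mathrm{K}\varphi:\varphi\text{ valid}\}$; $\mathbf{K}=\{\mathrm{K}(\varphi\rightarrow\psi)\rightarrow(\mathrm{K}\varphi\rightarrow\mathrm{K}\psi)\}$; $\mathbf{KK}=\{\mathrm{K}\varphi\rightarrow\mathrm{K}\mathrm{K}\varphi\}$ (all formulas of these forms). For a theory $T$ and a set $S$ of propositional atoms, $\mathscr M_{T,S}$ is the model with $\mathscr M_{T,S}\models p$ iff $p\in S$ for atoms $p$, and $\mathscr M_{T,S}\models\mathrm{K}\varphi$ iff $T\models\varphi$. A theory $T$ is generic if for every set $S$ of propositional atoms and every theory $T'\supseteq T$, $\mathscr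 M_{T',S}\models T$. -}

module Defs where

open import Data.Bool using (Bool; true; false; not; _∧_; _∨_)
open import Data.Product using (Σ; _×_; _,_)
open import Data.Sum using (_⊎_)
open import Relation.Binary.PropositionalEquality using (_≡_)
open import Function.Bundles using (_⇔_)

data Formula (A : Set) : Set where
  atom : A → Formula A
  ¬'   : Formula A → Formula A
  _∧'_ : Formula A → Formula A → Formula A
  _∨'_ : Formula A → Formula A → Formula A
  _⇒'_ : Formula A → Formula A → Formula A
  K    : Formula A → Formula A

-- A model assigns a truth value to every basic formula. Basic formulas are
-- the atoms p and the formulas K φ, so a model is given by its values on
-- atoms together with its values on the formulas K φ (indexed by φ).
record Model (A : Set) : Set where
  field
    atomVal : A → Bool
    KVal    : Formula A → Bool
open Model public

_⇒ᵇ_ : Bool → Bool → Bool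
x ⇒ᵇ y = not x ∨ y

eval : {A : Set} → Model A → Formula A → Bool
eval M (atom p) = atomVal M p
eval M (¬' φ)   = not (eval M φ)
eval M (φ ∧' ψ) = eval M φ ∧ eval M ψ
eval M (φ ∨' ψ) = eval M φ ∨ eval M ψ
eval M (φ ⇒' ψ) = eval M φ ⇒ᵇ eval M ψ
eval M (K φ)    = KVal M φ

_⊨_ : {A : Set} → Model A → Formula A → Set
M ⊨ φ = eval M φ ≡ true

Theory : Set → Set₁
Theory A = Formula A → Set

_⊨ᵀ_ : {A : Set} → Model A → Theory A → Set
M ⊨ᵀ T = ∀ φ → T φ → M ⊨ φ

_⊩_ : {A : Set} → Theory A → Formula A → Set
T ⊩ φ = ∀ M → M ⊨ᵀ T → M ⊨ φ

Valid : {A : Set} → Formula A → Set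
Valid φ = ∀ M → M ⊨ φ

_⊆ᵀ_ : {A : Set} → Theory A → Theory A → Set
T ⊆ᵀ T' = ∀ φ → T φ → T' φ

_∪ᵀ_ : {A : Set} → Theory A → Theory A → Theory A
(T ∪ᵀ U) φ = T φ ⊎ U φ

V : {A : Set} → Theory A
V ψ = Σ _ λ φ → (ψ ≡ K φ) × Valid φ

KAx : {A : Set} → Theory A
KAx χ = Σ _ λ φ → Σ _ λ ψ → χ ≡ (K (φ ⇒' ψ) ⇒' (K φ ⇒' K ψ))

KKAx : {A : Set} → Theory A
KKAx χ = Σ _ λ φ → χ ≡ (K φ ⇒' K (K φ))

-- Sets of atoms S are given by characteristic functions A → Bool.
-- IsM T S M : M is the model 𝓜_{T,S}, i.e. M ⊨ p iff p ∈ S, and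
-- M ⊨ K φ iff T ⊨ φ.  (This determines M uniquely.)
IsM : {A : Set} → Theory A → (A → Bool) → Model A → Set
IsM T S M = (∀ p → atomVal M p ≡ S p) × (∀ φ → (KVal M φ ≡ true) ⇔ (T ⊩ φ))

Generic : {A : Set} → Theory A → Set₁
Generic {A} T = ∀ (S : A → Bool) (T' : Theory A) → T ⊆ᵀ T' →
  Σ (Model A) λ M → IsM T' S M × M ⊨ᵀ T

{-# OPTIONS --safe #-}
module Submission where

-- If 𝓜_{T',S} satisfies the KK axioms, then T' ⊨ φ gives 𝓜_{T',S} ⊨ K φ, hence
-- 𝓜_{T',S} ⊨ K K φ, i.e. T' ⊨ K φ. So a generic theory containing KK forces every
-- extension T' to be closed under φ ↦ K φ. This fails for T' = V ∪ K ∪ KK ∪ {p}: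
-- reading K φ as "φ holds in the model N where every atom is false and every
-- K-formula true" gives a model of T' (N satisfies V, is closed under modus ponens
-- and believes every K ψ) in which K p is false.

open import Defs
open import Data.Bool using (Bool; true; false; not)
open import Data.Bool.Properties using (∨-inverseˡ; ∨-zeroʳ)
open import Data.Product using (_,_)
open import Data.Sum using (_⊎_; inj₁; inj₂)
open import Function.Bundles using (Equivalence)
open import Relation.Binary.PropositionalEquality using (_≡_; refl)
open import Relation.Nullary using (¬_)

⇒ᵇ-mp : ∀ {x y} → x ≡ true → (x ⇒ᵇ y) ≡ true → y ≡ true
⇒ᵇ-mp refl y≡true = y≡true

generic-KK⇒closed-under-K : {A : Set} {T T' : Theory A} → Generic T → KKAx ⊆ᵀ T →
                            T ⊆ᵀ T' → ∀ φ → T' ⊩ φ → T' ⊩ K φ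
generic-KK⇒closed-under-K {T' = T'} gen KK⊆T T⊆T' φ T'⊩φ
  with gen (λ _ → true) T' T⊆T'
... | M , (_ , KVal⇔⊩) , M⊨T = Equivalence.to (KVal⇔⊩ (K φ)) M⊨KKφ
  where
  M⊨Kφ : KVal M φ ≡ true
  M⊨Kφ = Equivalence.from (KVal⇔⊩ φ) T'⊩φ

  M⊨KKφ : KVal M (K φ) ≡ true
  M⊨KKφ = ⇒ᵇ-mp M⊨Kφ (M⊨T _ (KK⊆T _ (φ , refl)))

K-as-truth-in : {A : Set} → (A → Bool) → Model A → Model A
K-as-truth-in S N = record { atomVal = S ; KVal = eval N }

module _ {A : Set} (S : A → Bool) (N : Model A) where

  K-as-truth-in-⊨-V : K-as-truth-in S N ⊨ᵀ V
  K-as-truth-in-⊨-V _ (φ , refl , valid) = valid N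

  K-as-truth-in-⊨-KAx : K-as-truth-in S N ⊨ᵀ KAx
  K-as-truth-in-⊨-KAx _ (φ , ψ , refl) = ∨-inverseˡ (eval N φ ⇒ᵇ eval N ψ)

  K-as-truth-in-⊨-KKAx : (∀ φ → KVal N φ ≡ true) → K-as-truth-in S N ⊨ᵀ KKAx
  K-as-truth-in-⊨-KKAx N⊨K _ (φ , refl) rewrite N⊨K φ = ∨-zeroʳ (not (eval N φ))

theorem21 : (A : Set) → A → ¬ Generic {A} ((V ∪ᵀ KAx) ∪ᵀ KKAx)
theorem21 A a gen = T'⊮Kp (generic-KK⇒closed-under-K gen (λ _ → inj₂) (λ _ → inj₁) (atom a) T'⊩p)
  where
  T' : Theory A
  T' φ = ((V ∪ᵀ KAx) ∪ᵀ KKAx) φ ⊎ (φ ≡ atom a)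

  T'⊩p : T' ⊩ atom a
  T'⊩p _ M⊨T' = M⊨T' (atom a) (inj₂ refl)

  N : Model A
  N = record { atomVal = λ _ → false ; KVal = λ _ → true }

  C : Model A
  C = K-as-truth-in (λ _ → true) N

  C⊨T' : C ⊨ᵀ T'
  C⊨T' φ (inj₁ (inj₁ (inj₁ φ∈V)))   = K-as-truth-in-⊨-V _ N φ φ∈V
  C⊨T' φ (inj₁ (inj₁ (inj₂ φ∈KAx))) = K-as-truth-in-⊨-KAx _ N φ φ∈KAx
  C⊨T' φ (inj₁ (inj₂ φ∈KK))         = K-as-truth-in-⊨-KKAx _ N (λ _ → refl) φ φ∈KK
  C⊨T' φ (inj₂ refl)                = refl

  T'⊮Kp : ¬ (T' ⊩ K (atom a))
  T'⊮Kp T'⊩Kp with T'⊩Kp C C⊨T'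
  ... | ()
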